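{- Let $n$ be a positive integer and $k\in\{1,\dots,n-1\}$. Suppose $A\subseteq\mathbb{Z}/n\mathbb{Z}$ satisfies $0\in A$, $|A| = n/2$ and $(k+A)\cap A = \emptyset$, where $k+A = \{k+a : a\in A\}$. Let $d = \gcd(n,k)$. Then: (i) $n/d$ is even; (ii) $(d+A)\cap A = \emptyset$; (iii) $A$ is partitioned into the $d$ sets $O_0,\dots,O_{d-1}$, where for $j\in\{0,\dots,d-1\}$, $O_j = j+\langle 2d\rangle$ if $j\in A$ and $O_j = (j+d)+\langle 2d\rangle$ if $j\notin A$.
   Context: For $m\in\mathbb{Z}/n\mathbb{Z}$, $\langle m\rangle = \{im \bmod n : i\in\mathbb{Z}\}$ denotes the subgroup of $\mathbb{Z}/n\mathbb{Z}$ generated by $m$, and $j+\langle m\rangle$ its coset containing $j$. -}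

module Defs where

open import Data.Nat using (ℕ; _+_; _*_; NonZero; ≢-nonZero; ≢-nonZero⁻¹)
open import Data.Nat.DivMod using (m%n<n)
open import Data.Nat.GCD using (gcd; gcd[m,n]≢0)
open import Data.Integer using (ℤ; +_) renaming (_+_ to _+ℤ_; _*_ to _*ℤ_)
open import Data.Integer.DivMod using (_%ℕ_)
open import Data.Fin using (Fin; toℕ; fromℕ<)
open import Data.Fin.Subset using (Subset; _∈_; _∉_)
open import Data.Product using (_×_; ∃)
open import Data.Sum using (_⊎_; inj₁)
open import Relation.Binary.PropositionalEquality using (_≡_)

-- ℤ/nℤ is represented by Fin n (canonical representatives 0..n-1).

res : (n : ℕ) → .{{NonZero n}} → ℕ → Fin n
res n m = fromℕ< (m%n<n m n)

add : (n : ℕ) → .{{NonZero n}} → Fin n → Fin n → Fin n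
add n a b = res n (toℕ a + toℕ b)

InCoset : (n : ℕ) → .{{NonZero n}} → (j m : ℕ) → Fin n → Set
InCoset n j m x = ∃ λ (i : ℤ) → toℕ x ≡ ((+ j) +ℤ i *ℤ (+ m)) %ℕ n

O : (n : ℕ) → .{{NonZero n}} → Subset n → (d j : ℕ) → Fin n → Set
O n A d j x = (res n j ∈ A × InCoset n j (2 * d) x)
            ⊎ (res n j ∉ A × InCoset n (j + d) (2 * d) x)

gcd-nonZero : (n k : ℕ) → .{{NonZero n}} → NonZero (gcd n k)
gcd-nonZero n k = ≢-nonZero (gcd[m,n]≢0 n k (inj₁ (≢-nonZero⁻¹ n)))

module Submission where

-- Let member m say whether m mod n lies in A. As A and k + A are disjoint and each has
-- n/2 elements, they partition ℤ/nℤ, so member (k + m) = not (member m): k is an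
-- antiperiod of member, while n is a period. Periods and antiperiods together are closed
-- under sums, multiples and differences, so by Bézout d = gcd n k is one of the two; it
-- is not a period, since its multiple k is not. Hence d is an antiperiod, which is (ii);
-- the period n = (n/d)·d is then an even multiple of d, which is (i); and 2d is a period
-- with member (j + d) = not (member j), so for j < d exactly one of the residue classes
-- of j and j + d modulo 2d lies in A, which is (iii).

open import Algebra.Properties.CommutativeSemigroup using (interchange)
open import Data.Bool using (Bool; true; false; not)
open import Data.Bool.Properties using (not-involutive; not-¬)
open import Data.Empty using (⊥-elim)
open import Data.Fin using (Fin; toℕ; zero; suc)
open import Data.Fin.Properties using (toℕ-fromℕ<; toℕ-injective; toℕ<n)
open import Data.Fin.Subset using (Subset; ∣_∣; _∈_; _∉_)
open import Data.Nat
open import Data.Nat.DivMod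
open import Data.Nat.Divisibility using (_∣_; divides; _∣0; ∣-refl; ∣m∣n⇒∣m+n; ∣⇒≤; *-monoˡ-∣)
open import Data.Nat.GCD using (gcd; gcd-GCD; gcd[m,n]∣m; gcd[m,n]∣n; module Bézout)
open import Data.Nat.Properties
open import Data.Parity.Base as ℙ using (Parity; 0ℙ; 1ℙ)
import Data.Parity.Properties as ℙₚ
open import Data.Product using (_×_; _,_; ∃)
open import Data.Sum using (_⊎_; inj₁; inj₂)
open import Data.Vec using (lookup; _∷_; [])
open import Data.Vec.Properties using ([]=⇒lookup; lookup⇒[]=)
open import Function using (_∘_)
open import Function.Bundles using (_⇔_; mk⇔)
open import Relation.Binary.PropositionalEquality
open import Relation.Nullary using (¬_; yes; no)

open import Defs

sumBelow : (ℕ → ℕ) → ℕ → ℕ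
sumBelow g zero    = 0
sumBelow g (suc n) = g 0 + sumBelow (g ∘ suc) n

sumBelow-cong : ∀ {g h} n → (∀ m → m < n → g m ≡ h m) → sumBelow g n ≡ sumBelow h n
sumBelow-cong zero    g≡h = refl
sumBelow-cong (suc n) g≡h =
  cong₂ _+_ (g≡h 0 z<s) (sumBelow-cong n (λ m m<n → g≡h (suc m) (s<s m<n)))

sumBelow-distrib-+ : ∀ g h n → sumBelow (λ m → g m + h m) n ≡ sumBelow g n + sumBelow h n
sumBelow-distrib-+ g h zero    = refl
sumBelow-distrib-+ g h (suc n) =
  trans (cong (g 0 + h 0 +_) (sumBelow-distrib-+ (g ∘ suc) (h ∘ suc) n))
        (interchange +-commutativeSemigroup (g 0) (h 0) _ _)

sumBelow-suc : ∀ g n → sumBelow g (suc n) ≡ sumBelow g n + g n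
sumBelow-suc g zero    = +-comm (g 0) 0
sumBelow-suc g (suc n) =
  trans (cong (g 0 +_) (sumBelow-suc (g ∘ suc) n)) (sym (+-assoc (g 0) _ _))

sumBelow-rotate₁ : ∀ g n → g n ≡ g 0 → sumBelow (g ∘ suc) n ≡ sumBelow g n
sumBelow-rotate₁ g n gn≡g0 = +-cancelˡ-≡ (g 0) _ _ (begin
  g 0 + sumBelow (g ∘ suc) n  ≡⟨ sumBelow-suc g n ⟩
  sumBelow g n + g n          ≡⟨ cong (sumBelow g n +_) gn≡g0 ⟩
  sumBelow g n + g 0          ≡⟨ +-comm (sumBelow g n) (g 0) ⟩
  g 0 + sumBelow g n          ∎)
  where open ≡-Reasoning

sumBelow-rotate : ∀ g n k → (∀ m → g (n + m) ≡ g m) →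
                  sumBelow (λ m → g (k + m)) n ≡ sumBelow g n
sumBelow-rotate g n zero    periodic = refl
sumBelow-rotate g n (suc k) periodic = begin
  sumBelow (λ m → g (suc k + m)) n  ≡⟨ sumBelow-cong n (λ m _ → cong g (sym (+-suc k m))) ⟩
  sumBelow (λ m → g (k + suc m)) n  ≡⟨ sumBelow-rotate₁ (λ m → g (k + m)) n shifted-periodic ⟩
  sumBelow (λ m → g (k + m)) n      ≡⟨ sumBelow-rotate g n k periodic ⟩
  sumBelow g n                      ∎
  where
  open ≡-Reasoning
  shifted-periodic : g (k + n) ≡ g (k + 0)
  shifted-periodic = trans (cong g (+-comm k n)) (trans (periodic k) (cong g (sym (+-identityʳ k))))

sumBelow-≤ : ∀ g n → (∀ m → m < n → g m ≤ 1) → sumBelow g n ≤ n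
sumBelow-≤ g zero    g≤1 = z≤n
sumBelow-≤ g (suc n) g≤1 =
  +-mono-≤ (g≤1 0 z<s) (sumBelow-≤ (g ∘ suc) n (λ m m<n → g≤1 (suc m) (s<s m<n)))

sumBelow≡n⇒≡1 : ∀ g n → (∀ m → m < n → g m ≤ 1) → sumBelow g n ≡ n → ∀ m → m < n → g m ≡ 1
sumBelow≡n⇒≡1 g (suc n) g≤1 sum≡n = g≡1
  where
  tail≤1 : ∀ m → m < n → g (suc m) ≤ 1
  tail≤1 m m<n = g≤1 (suc m) (s<s m<n)

  head≡1 : g 0 ≡ 1
  head≡1 = ≤-antisym (g≤1 0 z<s) (+-cancelʳ-≤ n 1 (g 0) (begin
    1 + n                       ≡⟨ sum≡n ⟨
    g 0 + sumBelow (g ∘ suc) n  ≤⟨ +-monoʳ-≤ (g 0) (sumBelow-≤ (g ∘ suc) n tail≤1) ⟩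
    g 0 + n                     ∎))
    where open ≤-Reasoning

  tail≡n : sumBelow (g ∘ suc) n ≡ n
  tail≡n = suc-injective (trans (cong (_+ sumBelow (g ∘ suc) n) (sym head≡1)) sum≡n)

  g≡1 : ∀ m → m < suc n → g m ≡ 1
  g≡1 zero    _         = head≡1
  g≡1 (suc m) (s<s m<n) = sumBelow≡n⇒≡1 (g ∘ suc) n tail≤1 tail≡n m m<n

[m+n%d]%d≡[m+n]%d : ∀ m n d .{{_ : NonZero d}} → (m + n % d) % d ≡ (m + n) % d
[m+n%d]%d≡[m+n]%d m n d = begin
  (m + n % d) % d          ≡⟨ %-distribˡ-+ m (n % d) d ⟩
  (m % d + n % d % d) % d  ≡⟨ cong (λ r → (m % d + r) % d) (m%n%n≡m%n n d) ⟩
  (m % d + n % d) % d      ≡⟨ %-distribˡ-+ m n d ⟨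
  (m + n) % d              ∎
  where open ≡-Reasoning

parity≡0ℙ⇒2∣ : ∀ q → parity q ≡ 0ℙ → 2 ∣ q
parity≡0ℙ⇒2∣ zero          _    = 2 ∣0
parity≡0ℙ⇒2∣ (suc (suc q)) even = ∣m∣n⇒∣m+n (∣-refl {2}) (parity≡0ℙ⇒2∣ q even)

indicator : Bool → ℕ
indicator true  = 1
indicator false = 0

∣p∣≡sumBelow : ∀ {n} (p : Subset n) (g : ℕ → ℕ) →
               (∀ i → g (toℕ i) ≡ indicator (lookup p i)) → ∣ p ∣ ≡ sumBelow g n
∣p∣≡sumBelow []          g g≡ = refl
∣p∣≡sumBelow (true ∷ p)  g g≡ =
  cong₂ _+_ (sym (g≡ zero)) (∣p∣≡sumBelow p (g ∘ suc) (g≡ ∘ suc))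
∣p∣≡sumBelow (false ∷ p) g g≡ =
  cong₂ _+_ (sym (g≡ zero)) (∣p∣≡sumBelow p (g ∘ suc) (g≡ ∘ suc))

flipIf : Parity → Bool → Bool
flipIf 0ℙ b = b
flipIf 1ℙ b = not b

flipIf-+ : ∀ p q b → flipIf (p ℙ.+ q) b ≡ flipIf p (flipIf q b)
flipIf-+ 0ℙ q  b = refl
flipIf-+ 1ℙ 0ℙ b = refl
flipIf-+ 1ℙ 1ℙ b = sym (not-involutive b)

flipIf-involutive : ∀ p b → flipIf p (flipIf p b) ≡ b
flipIf-involutive 0ℙ b = refl
flipIf-involutive 1ℙ b = not-involutive b

flipIf-injectiveˡ : ∀ {p q} b → flipIf p b ≡ flipIf q b → p ≡ q
flipIf-injectiveˡ {0ℙ} {0ℙ} b eq = refl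
flipIf-injectiveˡ {1ℙ} {1ℙ} b eq = refl
flipIf-injectiveˡ {0ℙ} {1ℙ} b eq = ⊥-elim (not-¬ refl eq)
flipIf-injectiveˡ {1ℙ} {0ℙ} b eq = ⊥-elim (not-¬ refl (sym eq))

module SignedPeriods (f : ℕ → Bool) where

  -- s is a period of f for p = 0ℙ and an antiperiod for p = 1ℙ.
  record SignedPeriod (p : Parity) (s : ℕ) : Set where
    constructor signedPeriod
    field shift : ∀ m → f (s + m) ≡ flipIf p (f m)
  open SignedPeriod public

  signedPeriod-+ : ∀ {p q s t} → SignedPeriod p s → SignedPeriod q t →
                   SignedPeriod (p ℙ.+ q) (s + t)
  signedPeriod-+ {p} {q} {s} {t} sp tq = signedPeriod λ m → begin
    f (s + t + m)             ≡⟨ cong f (+-assoc s t m) ⟩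
    f (s + (t + m))           ≡⟨ shift sp (t + m) ⟩
    flipIf p (f (t + m))      ≡⟨ cong (flipIf p) (shift tq m) ⟩
    flipIf p (flipIf q (f m)) ≡⟨ flipIf-+ p q (f m) ⟨
    flipIf (p ℙ.+ q) (f m)    ∎
    where open ≡-Reasoning

  signedPeriod-cancelˡ : ∀ {p q s t u} → SignedPeriod p s → SignedPeriod q u → s + t ≡ u →
                         SignedPeriod (p ℙ.+ q) t
  signedPeriod-cancelˡ {p} {q} {s} {t} {u} sp uq s+t≡u = signedPeriod λ m → begin
    f (t + m)                            ≡⟨ flipIf-involutive p (f (t + m)) ⟨
    flipIf p (flipIf p (f (t + m)))      ≡⟨ cong (flipIf p) (shift sp (t + m)) ⟨
    flipIf p (f (s + (t + m)))           ≡⟨ cong (flipIf p ∘ f) (s+[t+m]≡u+m m) ⟩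
    flipIf p (f (u + m))                 ≡⟨ cong (flipIf p) (shift uq m) ⟩
    flipIf p (flipIf q (f m))            ≡⟨ flipIf-+ p q (f m) ⟨
    flipIf (p ℙ.+ q) (f m)               ∎
    where
    open ≡-Reasoning
    s+[t+m]≡u+m : ∀ m → s + (t + m) ≡ u + m
    s+[t+m]≡u+m m = trans (sym (+-assoc s t m)) (cong (_+ m) s+t≡u)

  signedPeriod-* : ∀ {p s} → SignedPeriod p s → ∀ q → SignedPeriod (parity q ℙ.* p) (q * s)
  signedPeriod-* sp zero    = signedPeriod λ m → refl
  signedPeriod-* {p} {s} sp (suc q) =
    subst (λ r → SignedPeriod r (suc q * s)) (sym parity[1+q]*p)
          (signedPeriod-+ sp (signedPeriod-* sp q))
    where
    parity[1+q]*p : parity (suc q) ℙ.* p ≡ p ℙ.+ (parity q ℙ.* p)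
    parity[1+q]*p = trans (cong (ℙ._* p) (ℙₚ.+-homo-+ 1 q)) (ℙₚ.*-distribʳ-+ p 1ℙ (parity q))

  period-* : ∀ {s} → SignedPeriod 0ℙ s → ∀ q → SignedPeriod 0ℙ (q * s)
  period-* {s} sp q =
    subst (λ r → SignedPeriod r (q * s)) (ℙₚ.*-zeroʳ (parity q)) (signedPeriod-* sp q)

  signedPeriod-unique : ∀ {p q s} → SignedPeriod p s → SignedPeriod q s → p ≡ q
  signedPeriod-unique sp sq = flipIf-injectiveˡ (f 0) (trans (sym (shift sp 0)) (shift sq 0))

  period-% : ∀ {s} .{{_ : NonZero s}} → SignedPeriod 0ℙ s → ∀ m → f (m % s) ≡ f m
  period-% {s} sp m = begin
    f (m % s)                ≡⟨ shift (period-* sp (m / s)) (m % s) ⟨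
    f (m / s * s + m % s)    ≡⟨ cong f (+-comm (m / s * s) (m % s)) ⟩
    f (m % s + m / s * s)    ≡⟨ cong f (m≡m%n+[m/n]*n m s) ⟨
    f m                      ∎
    where open ≡-Reasoning

  signedPeriod-fromBelow : ∀ {p s n} .{{_ : NonZero n}} → SignedPeriod 0ℙ n →
                           (∀ m → m < n → f (s + m) ≡ flipIf p (f m)) → SignedPeriod p s
  signedPeriod-fromBelow {p} {s} {n} np below = signedPeriod λ m → begin
    f (s + m)              ≡⟨ period-% np (s + m) ⟨
    f ((s + m) % n)        ≡⟨ cong f ([m+n%d]%d≡[m+n]%d s m n) ⟨
    f ((s + m % n) % n)    ≡⟨ period-% np (s + m % n) ⟩
    f (s + m % n)          ≡⟨ below (m % n) (m%n<n m n) ⟩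
    flipIf p (f (m % n))   ≡⟨ cong (flipIf p) (period-% np m) ⟩
    flipIf p (f m)         ∎
    where open ≡-Reasoning

  half-disjoint-translate⇒antiperiod :
    ∀ {n s} .{{_ : NonZero n}} → SignedPeriod 0ℙ n → 2 * sumBelow (indicator ∘ f) n ≡ n →
    (∀ m → f m ≡ true → f (s + m) ≡ false) → SignedPeriod 1ℙ s
  half-disjoint-translate⇒antiperiod {n} {s} np half disjoint =
    signedPeriod-fromBelow np λ m m<n →
      complement (f m) (f (s + m)) (sumBelow≡n⇒≡1 pair n (λ m _ → pair≤1 m) pairs≡n m m<n)
    where
    pair : ℕ → ℕ
    pair m = indicator (f m) + indicator (f (s + m))

    pair≤1 : ∀ m → pair m ≤ 1
    pair≤1 m with f m in fm
    ... | true  rewrite disjoint m fm = ≤-refl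
    ... | false with f (s + m)
    ...   | true  = ≤-refl
    ...   | false = z≤n

    pairs≡n : sumBelow pair n ≡ n
    pairs≡n = begin
      sumBelow pair n
        ≡⟨ sumBelow-distrib-+ (indicator ∘ f) (λ m → indicator (f (s + m))) n ⟩
      sumBelow (indicator ∘ f) n + sumBelow (λ m → indicator (f (s + m))) n
        ≡⟨ cong (sumBelow (indicator ∘ f) n +_)
                (sumBelow-rotate (indicator ∘ f) n s (cong indicator ∘ shift np)) ⟩
      sumBelow (indicator ∘ f) n + sumBelow (indicator ∘ f) n
        ≡⟨ cong (sumBelow (indicator ∘ f) n +_) (+-identityʳ _) ⟨
      2 * sumBelow (indicator ∘ f) n
        ≡⟨ half ⟩
      n ∎
      where open ≡-Reasoning

    complement : ∀ b c → indicator b + indicator c ≡ 1 → c ≡ not b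
    complement true  false _ = refl
    complement false true  _ = refl

  signedPeriod-gcd : ∀ {p q m n} → SignedPeriod p m → SignedPeriod q n →
                     ∃ λ r → SignedPeriod r (gcd m n)
  signedPeriod-gcd {m = m} {n} mp nq with Bézout.identity (gcd-GCD m n)
  ... | Bézout.+- x y d+yn≡xm = _ , signedPeriod-cancelˡ (signedPeriod-* nq y) (signedPeriod-* mp x)
                                                       (trans (+-comm (y * n) _) d+yn≡xm)
  ... | Bézout.-+ x y d+xm≡yn = _ , signedPeriod-cancelˡ (signedPeriod-* mp x) (signedPeriod-* nq y)
                                                       (trans (+-comm (x * m) _) d+xm≡yn)

  antiperiod-gcd : ∀ {p m n} → SignedPeriod p m → SignedPeriod 1ℙ n → SignedPeriod 1ℙ (gcd m n)
  antiperiod-gcd {m = m} {n} mp nq with signedPeriod-gcd mp nq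
  ... | r , dr = subst (λ r → SignedPeriod r (gcd m n)) (right-factor r≡1ℙ) dr
    where
    open _∣_ (gcd[m,n]∣n m n) renaming (quotient to k)
    r≡1ℙ : parity k ℙ.* r ≡ 1ℙ
    r≡1ℙ = signedPeriod-unique (subst (SignedPeriod _) (sym equality) (signedPeriod-* dr k)) nq
    right-factor : ∀ {p q} → p ℙ.* q ≡ 1ℙ → q ≡ 1ℙ
    right-factor {1ℙ} eq = eq

  antiperiod-multiple-period⇒even : ∀ {q s} → SignedPeriod 1ℙ s → SignedPeriod 0ℙ (q * s) → 2 ∣ q
  antiperiod-multiple-period⇒even {q} sp qsp = parity≡0ℙ⇒2∣ q (begin
    parity q         ≡⟨ ℙₚ.*-identityʳ (parity q) ⟨
    parity q ℙ.* 1ℙ  ≡⟨ signedPeriod-unique (signedPeriod-* sp q) qsp ⟩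
    0ℙ               ∎)
    where open ≡-Reasoning

toℕ-res : ∀ n .{{_ : NonZero n}} m → toℕ (res n m) ≡ m % n
toℕ-res n m = toℕ-fromℕ< (m%n<n m n)

res-cong : ∀ n .{{_ : NonZero n}} {m m′} → m % n ≡ m′ % n → res n m ≡ res n m′
res-cong n eq = toℕ-injective (trans (toℕ-res n _) (trans eq (sym (toℕ-res n _))))

res-toℕ : ∀ n .{{_ : NonZero n}} (x : Fin n) → res n (toℕ x) ≡ x
res-toℕ n x = toℕ-injective (trans (toℕ-res n (toℕ x)) (m<n⇒m%n≡m (toℕ<n x)))

add-resʳ : ∀ n .{{_ : NonZero n}} x m → add n x (res n m) ≡ res n (toℕ x + m)
add-resʳ n x m =
  res-cong n (trans (cong (λ r → (toℕ x + r) % n) (toℕ-res n m)) ([m+n%d]%d≡[m+n]%d (toℕ x) m n))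

add-resˡ : ∀ n .{{_ : NonZero n}} m x → add n (res n m) x ≡ res n (m + toℕ x)
add-resˡ n m x = begin
  res n (toℕ (res n m) + toℕ x)  ≡⟨ cong (res n) (+-comm (toℕ (res n m)) (toℕ x)) ⟩
  add n x (res n m)              ≡⟨ add-resʳ n x m ⟩
  res n (toℕ x + m)              ≡⟨ cong (res n) (+-comm (toℕ x) m) ⟩
  res n (m + toℕ x)              ∎
  where open ≡-Reasoning

module Membership (n : ℕ) .{{_ : NonZero n}} (A : Subset n) where

  member : ℕ → Bool
  member m = lookup A (res n m)

  open SignedPeriods member public

  res∈⇒member : ∀ {m} → res n m ∈ A → member m ≡ true
  res∈⇒member = []=⇒lookup

  member⇒res∈ : ∀ {m} → member m ≡ true → res n m ∈ A
  member⇒res∈ = lookup⇒[]= _ A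

  ∈⇒member : ∀ {x} → x ∈ A → member (toℕ x) ≡ true
  ∈⇒member {x} x∈A = res∈⇒member (subst (_∈ A) (sym (res-toℕ n x)) x∈A)

  member⇒∈ : ∀ {x} → member (toℕ x) ≡ true → x ∈ A
  member⇒∈ {x} eq = subst (_∈ A) (res-toℕ n x) (member⇒res∈ eq)

  ∉⇒member≡false : ∀ {m} → res n m ∉ A → member m ≡ false
  ∉⇒member≡false {m} m∉A with member m in m∈
  ... | true  = ⊥-elim (m∉A (member⇒res∈ m∈))
  ... | false = refl

  member≡false⇒∉ : ∀ {m} → member m ≡ false → res n m ∉ A
  member≡false⇒∉ m∉ m∈A = not-¬ refl (trans (sym (res∈⇒member m∈A)) m∉)

  member-periodic : SignedPeriod 0ℙ n
  member-periodic = signedPeriod λ m →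
    cong (lookup A) (res-cong n (trans (cong (_% n) (+-comm n m)) ([m+n]%n≡m%n m n)))

  ∣A∣≡sumBelow : ∣ A ∣ ≡ sumBelow (indicator ∘ member) n
  ∣A∣≡sumBelow =
    ∣p∣≡sumBelow A (indicator ∘ member) (λ i → cong (indicator ∘ lookup A) (res-toℕ n i))

  disjoint-translate⇒antiperiod : ∀ k → 2 * ∣ A ∣ ≡ n → (∀ a → a ∈ A → add n k a ∉ A) →
                                  SignedPeriod 1ℙ (toℕ k)
  disjoint-translate⇒antiperiod k half disjoint =
    half-disjoint-translate⇒antiperiod member-periodic
      (trans (cong (2 *_) (sym ∣A∣≡sumBelow)) half) member-disjoint
    where
    member-disjoint : ∀ m → member m ≡ true → member (toℕ k + m) ≡ false
    member-disjoint m m∈ with member (toℕ k + m) in k+m∈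
    ... | false = refl
    ... | true  = ⊥-elim (disjoint (res n m) (member⇒res∈ m∈)
                          (subst (_∈ A) (sym (add-resʳ n k m)) (member⇒res∈ k+m∈)))

  antiperiod⇒disjoint-translate : ∀ {s} → SignedPeriod 1ℙ s →
                                  ∀ a → a ∈ A → add n (res n s) a ∉ A
  antiperiod⇒disjoint-translate {s} sp a a∈A s+a∈A = not-¬ refl (begin
    true                     ≡⟨ res∈⇒member (subst (_∈ A) (add-resˡ n s a) s+a∈A) ⟨
    member (s + toℕ a)       ≡⟨ shift sp (toℕ a) ⟩
    not (member (toℕ a))     ≡⟨ cong not (∈⇒member a∈A) ⟩
    not true                 ∎)
    where open ≡-Reasoning

module Cosets where
  open import Data.Integer.Base as ℤ using (ℤ; +_; -[1+_])
  import Data.Integer.Properties as ℤₚ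
  open import Data.Integer.DivMod using (_%ℕ_; _/ℕ_; a≡a%ℕn+[a/ℕn]*n)
  open import Data.Integer.Tactic.RingSolver using (solve-∀)

  pos-+-* : ∀ x a M → + (x + a * M) ≡ + x ℤ.+ + a ℤ.* + M
  pos-+-* x a M = trans (ℤₚ.pos-+ x (a * M)) (cong (ℤ._+_ (+ x)) (ℤₚ.pos-* a M))

  +x+cM≡+y⇒x%M≡y%M : ∀ x y M .{{_ : NonZero M}} c → + x ℤ.+ c ℤ.* + M ≡ + y → x % M ≡ y % M
  +x+cM≡+y⇒x%M≡y%M x y M (+ a) eq =
    trans (sym ([m+kn]%n≡m%n x a M)) (cong (_% M) (ℤₚ.+-injective (trans (pos-+-* x a M) eq)))
  +x+cM≡+y⇒x%M≡y%M x y M -[1+ a ] eq =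
    sym (trans (sym ([m+kn]%n≡m%n y (suc a) M)) (cong (_% M) (ℤₚ.+-injective (begin
      + (y + suc a * M)                                 ≡⟨ pos-+-* y (suc a) M ⟩
      + y ℤ.+ + suc a ℤ.* + M                           ≡⟨ cong (λ w → w ℤ.+ + suc a ℤ.* + M) eq ⟨
      + x ℤ.+ -[1+ a ] ℤ.* + M ℤ.+ + suc a ℤ.* + M      ≡⟨ cancel (+ x) (+ suc a) (+ M) ⟩
      + x                                               ∎))))
    where
    open ≡-Reasoning
    cancel : ∀ X T M → X ℤ.+ (ℤ.- T) ℤ.* M ℤ.+ T ℤ.* M ≡ X
    cancel = solve-∀

  InCoset⇒%≡ : ∀ n .{{_ : NonZero n}} {r M} .{{_ : NonZero M}} x → M ∣ n → InCoset n r M x →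
               toℕ x % M ≡ r % M
  InCoset⇒%≡ n {r} {M} x (divides e n≡eM) (i , x≡z%n) =
    +x+cM≡+y⇒x%M≡y%M (toℕ x) r M (Q ℤ.* + e ℤ.- i) (begin
      + toℕ x ℤ.+ (Q ℤ.* + e ℤ.- i) ℤ.* + M        ≡⟨ rearrange (+ toℕ x) Q (+ e) i (+ M) ⟩
      + toℕ x ℤ.+ Q ℤ.* (+ e ℤ.* + M) ℤ.- i ℤ.* + M ≡⟨ cong (λ w → w ℤ.- i ℤ.* + M) x+Qn≡z ⟩
      z ℤ.- i ℤ.* + M                               ≡⟨ cancel (+ r) i (+ M) ⟩
      + r                                           ∎)
    where
    open ≡-Reasoning
    z : ℤ
    z = + r ℤ.+ i ℤ.* + M
    Q : ℤ
    Q = z /ℕ n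
    x+Qn≡z : + toℕ x ℤ.+ Q ℤ.* (+ e ℤ.* + M) ≡ z
    x+Qn≡z = sym (trans (a≡a%ℕn+[a/ℕn]*n z n)
      (cong₂ (λ a b → + a ℤ.+ Q ℤ.* b) (sym x≡z%n) (trans (cong +_ n≡eM) (ℤₚ.pos-* e M))))
    rearrange : ∀ X Q E I M → X ℤ.+ (Q ℤ.* E ℤ.- I) ℤ.* M ≡ X ℤ.+ Q ℤ.* (E ℤ.* M) ℤ.- I ℤ.* M
    rearrange = solve-∀
    cancel : ∀ R I M → R ℤ.+ I ℤ.* M ℤ.- I ℤ.* M ≡ R
    cancel = solve-∀

  %≡⇒InCoset : ∀ n .{{_ : NonZero n}} {r M} .{{_ : NonZero M}} x → toℕ x % M ≡ r → InCoset n r M x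
  %≡⇒InCoset n {r} {M} x x%M≡r = + q , (begin
    toℕ x                      ≡⟨ m<n⇒m%n≡m (toℕ<n x) ⟨
    toℕ x % n                  ≡⟨ cong (_% n) (m≡m%n+[m/n]*n (toℕ x) M) ⟩
    (toℕ x % M + q * M) % n    ≡⟨ cong (λ w → (w + q * M) % n) x%M≡r ⟩
    (r + q * M) % n            ≡⟨ cong (_%ℕ n) (pos-+-* r q M) ⟩
    (+ r ℤ.+ + q ℤ.* + M) %ℕ n ∎)
    where
    open ≡-Reasoning
    q : ℕ
    q = toℕ x / M

open Cosets using (InCoset⇒%≡; %≡⇒InCoset)

module Partition (n : ℕ) .{{_ : NonZero n}} (A : Subset n) (d : ℕ) .{{_ : NonZero d}}
                 (antiperiod : Membership.SignedPeriod n A 1ℙ d) (2d∣n : 2 * d ∣ n) where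

  open Membership n A

  instance
    2d-nonZero : NonZero (2 * d)
    2d-nonZero = m*n≢0 2 d

  member-%2d : ∀ m → member (m % (2 * d)) ≡ member m
  member-%2d = period-% (signedPeriod-* antiperiod 2)

  InCoset⇒member≡ : ∀ {r x} → InCoset n r (2 * d) x → member (toℕ x) ≡ member r
  InCoset⇒member≡ {r} {x} x∈r+⟨2d⟩ = begin
    member (toℕ x)              ≡⟨ member-%2d (toℕ x) ⟨
    member (toℕ x % (2 * d))    ≡⟨ cong member (InCoset⇒%≡ n x 2d∣n x∈r+⟨2d⟩) ⟩
    member (r % (2 * d))        ≡⟨ member-%2d r ⟩
    member r                    ∎
    where open ≡-Reasoning

  member[j+d] : ∀ j → member (j + d) ≡ not (member j)
  member[j+d] j = trans (cong member (+-comm j d)) (shift antiperiod j)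

  2d≡d+d : 2 * d ≡ d + d
  2d≡d+d = cong (d +_) (+-identityʳ d)

  j<2d : ∀ {j} → j < d → j < 2 * d
  j<2d j<d = <-≤-trans j<d (m≤m+n d (d + 0))

  j+d<2d : ∀ {j} → j < d → j + d < 2 * d
  j+d<2d {j} j<d = subst (j + d <_) (sym 2d≡d+d) (+-monoˡ-< d j<d)

  toℕ-res-%2d : ∀ {r} → r < 2 * d → toℕ (res n r) % (2 * d) ≡ r
  toℕ-res-%2d {r} r<2d = begin
    toℕ (res n r) % (2 * d)  ≡⟨ cong (_% (2 * d)) (toℕ-res n r) ⟩
    r % n % (2 * d)          ≡⟨ cong (_% (2 * d)) (m<n⇒m%n≡m (<-≤-trans r<2d (∣⇒≤ 2d∣n))) ⟩
    r % (2 * d)              ≡⟨ m<n⇒m%n≡m r<2d ⟩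
    r                        ∎
    where open ≡-Reasoning

  O-residue : ∀ {j x} → j < d → O n A d j x → toℕ x % (2 * d) ≡ j ⊎ toℕ x % (2 * d) ≡ j + d
  O-residue j<d (inj₁ (_ , x∈j+⟨2d⟩)) =
    inj₁ (trans (InCoset⇒%≡ n _ 2d∣n x∈j+⟨2d⟩) (m<n⇒m%n≡m (j<2d j<d)))
  O-residue j<d (inj₂ (_ , x∈j+d+⟨2d⟩)) =
    inj₂ (trans (InCoset⇒%≡ n _ 2d∣n x∈j+d+⟨2d⟩) (m<n⇒m%n≡m (j+d<2d j<d)))

  ∈⇒O : ∀ x → x ∈ A → ∃ λ j → j < d × O n A d j x
  ∈⇒O x x∈A with toℕ x % (2 * d) <? d
  ... | yes r<d = toℕ x % (2 * d) , r<d ,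
                  inj₁ (member⇒res∈ (trans (member-%2d (toℕ x)) (∈⇒member x∈A)) ,
                        %≡⇒InCoset n x refl)
  ... | no  r≮d = j , j<d , inj₂ (member≡false⇒∉ member-j , %≡⇒InCoset n x (sym j+d≡r))
    where
    r = toℕ x % (2 * d)
    j = r ∸ d
    j+d≡r : j + d ≡ r
    j+d≡r = m∸n+n≡m (≮⇒≥ r≮d)
    j<d : j < d
    j<d = +-cancelʳ-< d j d (subst₂ _<_ (sym j+d≡r) 2d≡d+d (m%n<n (toℕ x) (2 * d)))
    member-j : member j ≡ false
    member-j = begin
      member j                     ≡⟨ not-involutive (member j) ⟨
      not (not (member j))         ≡⟨ cong not (member[j+d] j) ⟨
      not (member (j + d))         ≡⟨ cong (not ∘ member) j+d≡r ⟩
      not (member r)               ≡⟨ cong not (trans (member-%2d (toℕ x)) (∈⇒member x∈A)) ⟩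
      false                        ∎
      where open ≡-Reasoning

  O⇒∈ : ∀ x → (∃ λ j → j < d × O n A d j x) → x ∈ A
  O⇒∈ x (j , _ , inj₁ (j∈A , x∈j+⟨2d⟩)) =
    member⇒∈ (trans (InCoset⇒member≡ x∈j+⟨2d⟩) (res∈⇒member j∈A))
  O⇒∈ x (j , _ , inj₂ (j∉A , x∈j+d+⟨2d⟩)) =
    member⇒∈ (trans (InCoset⇒member≡ x∈j+d+⟨2d⟩)
                    (trans (member[j+d] j) (cong not (∉⇒member≡false j∉A))))

  O-disjoint : ∀ j j′ → j < d → j′ < d → j ≢ j′ → ∀ x → ¬ (O n A d j x × O n A d j′ x)
  O-disjoint j j′ j<d j′<d j≢j′ x (x∈Oj , x∈Oj′) with O-residue j<d x∈Oj | O-residue j′<d x∈Oj′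
  ... | inj₁ r≡j   | inj₁ r≡j′   = j≢j′ (trans (sym r≡j) r≡j′)
  ... | inj₁ r≡j   | inj₂ r≡j′+d = <⇒≱ j<d (subst (d ≤_) (trans (sym r≡j′+d) r≡j) (m≤n+m d j′))
  ... | inj₂ r≡j+d | inj₁ r≡j′   = <⇒≱ j′<d (subst (d ≤_) (trans (sym r≡j+d) r≡j′) (m≤n+m d j))
  ... | inj₂ r≡j+d | inj₂ r≡j′+d = j≢j′ (+-cancelʳ-≡ d j j′ (trans (sym r≡j+d) r≡j′+d))

  O-nonempty : ∀ j → j < d → ∃ λ x → O n A d j x
  O-nonempty j j<d with member j in member-j
  ... | true  = res n j ,
                inj₁ (member⇒res∈ member-j ,
                      %≡⇒InCoset n (res n j) (toℕ-res-%2d (j<2d j<d)))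
  ... | false = res n (j + d) ,
                inj₂ (member≡false⇒∉ member-j ,
                      %≡⇒InCoset n (res n (j + d)) (toℕ-res-%2d (j+d<2d j<d)))

proposition2p8 : (n : ℕ) .{{_ : NonZero n}} (k : Fin n) → 0 < toℕ k →
    (A : Subset n) → res n 0 ∈ A → 2 * ∣ A ∣ ≡ n →
    (∀ a → a ∈ A → add n k a ∉ A) →
    (2 ∣ (n / gcd n (toℕ k)) {{gcd-nonZero n (toℕ k)}})
    × (∀ a → a ∈ A → add n (res n (gcd n (toℕ k))) a ∉ A)
    × ((∀ x → (x ∈ A) ⇔ (∃ λ j → j < gcd n (toℕ k) × O n A (gcd n (toℕ k)) j x))
       × (∀ j j' → j < gcd n (toℕ k) → j' < gcd n (toℕ k) → j ≢ j' →
            ∀ x → ¬ (O n A (gcd n (toℕ k)) j x × O n A (gcd n (toℕ k)) j' x))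
       × (∀ j → j < gcd n (toℕ k) → ∃ λ x → O n A (gcd n (toℕ k)) j x))
proposition2p8 n k _ A _ half disjoint =
  n/d-even , antiperiod⇒disjoint-translate d-antiperiod ,
  (λ x → mk⇔ (∈⇒O x) (O⇒∈ x)) , O-disjoint , O-nonempty
  where
  open Membership n A

  d : ℕ
  d = gcd n (toℕ k)

  instance
    d-nonZero : NonZero d
    d-nonZero = gcd-nonZero n (toℕ k)

  n/d*d≡n : n / d * d ≡ n
  n/d*d≡n = m/n*n≡m (gcd[m,n]∣m n (toℕ k))

  d-antiperiod : SignedPeriod 1ℙ d
  d-antiperiod = antiperiod-gcd member-periodic (disjoint-translate⇒antiperiod k half disjoint)

  n/d-even : 2 ∣ n / d
  n/d-even = antiperiod-multiple-period⇒even d-antiperiod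
               (subst (SignedPeriod 0ℙ) (sym n/d*d≡n) member-periodic)

  open Partition n A d d-antiperiod (subst (2 * d ∣_) n/d*d≡n (*-monoˡ-∣ d n/d-even))
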